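{- Let $G$ be a finite graph of order $2k$ that is vertex-transitive, twin-free, and has co-twins. If $G$ is triangle-free, then $\mathrm{Aut}(G)\cong S_k\times S_2$.
   Context: $N(u)$ is the open and $N[u]=N(u)\cup\{u\}$ the closed neighborhood of $u$. A graph is twin-free if no two distinct vertices have equal open neighborhoods and no two distinct vertices have equal closed neighborhoods. Co-twins means nonadjacent co-twins: distinct vertices $u,v$ with $N[u]\cap N[v]=\emptyset$ and $N[u]\cup N[v]=V(G)$. -}

module Defs where

open import Data.Nat using (ℕ)
open import Data.Fin using (Fin; _≟_)
open import Data.Fin.Permutation as P using (Permutation′; _⟨$⟩ʳ_; _∘ₚ_)
open import Data.Bool using (Bool; true; false; _∧_; _∨_)
open import Data.Product using (Σ; ∃; ∃-syntax; _×_; _,_; proj₁)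
open import Relation.Nullary using (¬_)
open import Relation.Nullary.Decidable using (⌊_⌋)
open import Relation.Binary.PropositionalEquality using (_≡_; _≢_; trans)

record Graph (n : ℕ) : Set where
  field
    adj   : Fin n → Fin n → Bool
    sym   : ∀ u v → adj u v ≡ adj v u
    irrfl : ∀ u → adj u u ≡ false
open Graph public

module _ {n : ℕ} (G : Graph n) where

  openN : Fin n → Fin n → Bool
  openN u w = adj G u w

  closedN : Fin n → Fin n → Bool
  closedN u w = ⌊ u ≟ w ⌋ ∨ adj G u w

  TwinFree : Set
  TwinFree = ∀ u v → u ≢ v →
               ¬ (∀ w → openN u w ≡ openN v w) × ¬ (∀ w → closedN u w ≡ closedN v w)

  CoTwins : Fin n → Fin n → Set
  CoTwins u v = u ≢ v × (∀ w → closedN u w ∧ closedN v w ≡ false)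
                      × (∀ w → closedN u w ∨ closedN v w ≡ true)

  HasCoTwins : Set
  HasCoTwins = ∃[ u ] ∃[ v ] CoTwins u v

  TriangleFree : Set
  TriangleFree = ¬ (∃[ u ] ∃[ v ] ∃[ w ]
                    (adj G u v ≡ true × adj G v w ≡ true × adj G u w ≡ true))

  IsAutomorphism : Permutation′ n → Set
  IsAutomorphism σ = ∀ u v → adj G (σ ⟨$⟩ʳ u) (σ ⟨$⟩ʳ v) ≡ adj G u v

  Aut : Set
  Aut = Σ (Permutation′ n) IsAutomorphism

  _∘ᴬ_ : Aut → Aut → Aut
  (σ , p) ∘ᴬ (τ , q) = (σ ∘ₚ τ) , λ u v → trans (q (σ ⟨$⟩ʳ u) (σ ⟨$⟩ʳ v)) (p u v)

  _≈ᴬ_ : Aut → Aut → Set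
  a ≈ᴬ b = proj₁ a P.≈ proj₁ b

  VertexTransitive : Set
  VertexTransitive = ∀ u v → ∃[ σ ] (IsAutomorphism σ × σ ⟨$⟩ʳ u ≡ v)

Sym×S₂ : ℕ → Set
Sym×S₂ k = Permutation′ k × Permutation′ 2

_∘ˢ_ : ∀ {k} → Sym×S₂ k → Sym×S₂ k → Sym×S₂ k
(a , b) ∘ˢ (c , d) = (a ∘ₚ c) , (b ∘ₚ d)

_≈ˢ_ : ∀ {k} → Sym×S₂ k → Sym×S₂ k → Set
(a , b) ≈ˢ (c , d) = (a P.≈ c) × (b P.≈ d)

record AutIso {n : ℕ} (G : Graph n) (k : ℕ) : Set where
  field
    to      : Aut G → Sym×S₂ k
    from    : Sym×S₂ k → Aut G
    to-cong   : ∀ {a b} → _≈ᴬ_ G a b → to a ≈ˢ to b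
    from-cong : ∀ {x y} → x ≈ˢ y → _≈ᴬ_ G (from x) (from y)
    to-hom  : ∀ a b → to (_∘ᴬ_ G a b) ≈ˢ (to a ∘ˢ to b)
    to-from : ∀ x → to (from x) ≈ˢ x
    from-to : ∀ a → _≈ᴬ_ G (from (to a)) a

-- By vertex transitivity every vertex x has a co-twin c x, unique by twin-freeness, so c is an
-- involution. For co-twins u, v, triangle-freeness makes {u} ∪ N(v) and {v} ∪ N(u) independent,
-- so they 2-colour G, and c swaps the two colours; two vertices of different colours are then
-- adjacent unless they are co-twins. Indexing the co-twin pairs by Fin m therefore presents G as
-- the crown graph on Fin m × Bool, with 2m = 2k. Twin-freeness forces m ≥ 3, which makes the crown
-- graph connected, so an automorphism either keeps or swaps the colour classes as a whole; as it
-- also maps co-twin pairs to co-twin pairs, it is a permutation of the indices times an element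
-- of S₂, and conversely every such pair is an automorphism.

module Submission where

open import Defs renaming (sym to adj-sym)
open import Data.Nat using (ℕ; zero; suc; _*_; _≤_; z≤n; s≤s)
open import Data.Nat.Properties using (*-comm; *-cancelʳ-≡)
open import Data.Fin using (Fin; zero; suc; _≟_; fromℕ<; punchIn; punchOut)
open import Data.Fin.Properties using (2↔Bool; *↔×; punchInᵢ≢i; punchIn-injective; punchIn-punchOut)
open import Data.Fin.Permutation as P using (Permutation′; _⟨$⟩ʳ_; _∘ₚ_)
open import Data.Bool using (Bool; true; false; not; _∧_; _∨_; _xor_; T; if_then_else_)
open import Data.Bool.Properties as Bool
  using (T-≡; T-irrelevant; not-involutive; not-¬; ¬-not; ∧-comm; ∨-comm; ∧-zeroʳ; ∨-zeroʳ; ∨-conicalʳ;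
         xor-same; xor-inverseˡ; xor-inverseʳ; xor-annihilates-not; not-distribˡ-xor)
open import Data.Product using (Σ; ∃-syntax; _×_; _,_; proj₁; proj₂; map)
open import Data.Product.Properties using (Σ-≡,≡→≡; ≡-dec; ,-injectiveˡ)
open import Data.Product.Function.NonDependent.Propositional using (_×-↔_)
open import Data.Sum using (_⊎_; inj₁; inj₂)
open import Data.Empty using (⊥-elim)
open import Function using (_∘_; _$_; id; case_of_; _↔_; mk↔ₛ′; Inverse; Equivalence; Injection)
open import Function.Properties.Inverse using (↔-refl; ↔-sym; ↔-trans; ↔⇒↣)
open import Relation.Nullary using (¬_; Dec; yes; no; contradiction)
open import Relation.Nullary.Decidable using (⌊_⌋; isYes≗does; dec-true; dec-false; decidable-stable)
open import Relation.Binary.Definitions using (DecidableEquality)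
open import Relation.Binary.PropositionalEquality

∨-true : ∀ {p q} → p ∨ q ≡ true → p ≡ true ⊎ q ≡ true
∨-true {true}  _ = inj₁ refl
∨-true {false} q = inj₂ q

partition⇒≡not : ∀ {p q} → p ∧ q ≡ false → p ∨ q ≡ true → q ≡ not p
partition⇒≡not {true}  p∧q _ = p∧q
partition⇒≡not {false} _ p∨q = p∨q

xor-moveˡ : ∀ a {x d} → a xor x ≡ d → x ≡ a xor d
xor-moveˡ false e = e
xor-moveˡ true {x} e = trans (sym (not-involutive x)) (cong not e)

xor-cancelʳ : ∀ d a b → (a xor d) xor (b xor d) ≡ a xor b
xor-cancelʳ d true  true  = xor-same (not d)
xor-cancelʳ d true  false = xor-inverseˡ d
xor-cancelʳ d false true  = xor-inverseʳ d
xor-cancelʳ d false false = xor-same d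

⌊⌋-yes : ∀ {A : Set} (a? : Dec A) → A → ⌊ a? ⌋ ≡ true
⌊⌋-yes a? a = trans (isYes≗does a?) (dec-true a? a)

⌊⌋-no : ∀ {A : Set} (a? : Dec A) → ¬ A → ⌊ a? ⌋ ≡ false
⌊⌋-no a? ¬a = trans (isYes≗does a?) (dec-false a? ¬a)

⌊≟⌋-injective : ∀ {A B : Set} (_≟ᴬ_ : DecidableEquality A) (_≟ᴮ_ : DecidableEquality B) {f : A → B} →
                (∀ {x y} → f x ≡ f y → x ≡ y) → ∀ x y → ⌊ f x ≟ᴮ f y ⌋ ≡ ⌊ x ≟ᴬ y ⌋
⌊≟⌋-injective _≟ᴬ_ _≟ᴮ_ {f} f-inj x y with x ≟ᴬ y
... | yes refl = ⌊⌋-yes (f x ≟ᴮ f x) refl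
... | no x≢y   = ⌊⌋-no (f x ≟ᴮ f y) (x≢y ∘ f-inj)

↔-injective : ∀ {A B : Set} (φ : A ↔ B) {x y} → Inverse.to φ x ≡ Inverse.to φ y → x ≡ y
↔-injective φ = Injection.injective (↔⇒↣ φ)

∀-via : ∀ {A B : Set} (φ : A ↔ B) {P : B → Set} → (∀ x → P (Inverse.to φ x)) → ∀ y → P y
∀-via φ {P} h y = subst P (Inverse.strictlyInverseˡ φ y) (h (Inverse.from φ y))

-- Enumerating a decidable subset of Fin n

count : ∀ {n} → (Fin n → Bool) → ℕ
count {zero}  P = zero
count {suc n} P = if P zero then suc (count (P ∘ suc)) else count (P ∘ suc)

private
  enumerate-suc : ∀ {m n} (P : Fin (suc n) → Bool) →
           Fin m ↔ Σ (Fin n) (T ∘ P ∘ suc) → Fin (if P zero then suc m else m) ↔ Σ (Fin (suc n)) (T ∘ P)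
  enumerate-suc {m} P E with P zero in P0
  ... | true = mk↔ₛ′ to from to-from from-to
    where
      module E = Inverse E
      to : Fin (suc m) → Σ (Fin (suc _)) (T ∘ P)
      to zero    = zero , Equivalence.from T-≡ P0
      to (suc i) = map suc id (E.to i)
      from : Σ (Fin (suc _)) (T ∘ P) → Fin (suc m)
      from (zero  , _) = zero
      from (suc x , p) = suc (E.from (x , p))
      to-from : ∀ y → to (from y) ≡ y
      to-from (zero  , p) = cong (zero ,_) (T-irrelevant _ p)
      to-from (suc x , p) = cong (map suc id) (E.strictlyInverseˡ (x , p))
      from-to : ∀ i → from (to i) ≡ i
      from-to zero    = refl
      from-to (suc i) = cong suc (E.strictlyInverseʳ i)
  ... | false = mk↔ₛ′ to from to-from E.strictlyInverseʳ
    where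
      module E = Inverse E
      to : Fin m → Σ (Fin (suc _)) (T ∘ P)
      to i = map suc id (E.to i)
      from : Σ (Fin (suc _)) (T ∘ P) → Fin m
      from (zero  , p) = ⊥-elim (subst T P0 p)
      from (suc x , p) = E.from (x , p)
      to-from : ∀ y → to (from y) ≡ y
      to-from (zero  , p) = ⊥-elim (subst T P0 p)
      to-from (suc x , p) = cong (map suc id) (E.strictlyInverseˡ (x , p))

enumerate : ∀ {n} (P : Fin n → Bool) → Fin (count P) ↔ Σ (Fin n) (T ∘ P)
enumerate {zero}  P = mk↔ₛ′ (λ ()) (λ ()) (λ ()) (λ ())
enumerate {suc n} P = enumerate-suc P (enumerate (P ∘ suc))

module Halving {n} (s : Fin n → Bool) (c : Fin n → Fin n)
                (c-involutive : ∀ x → c (c x) ≡ x) (s-c : ∀ x → s (c x) ≡ not (s x)) where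

  private
    module E = Inverse (enumerate s)

    pair : Fin n → Bool → Fin n
    pair x true  = x
    pair x false = c x

    s-pair : ∀ {x} → T (s x) → ∀ b → s (pair x b) ≡ b
    s-pair p true  = Equivalence.to T-≡ p
    s-pair p false = trans (s-c _) (cong not (Equivalence.to T-≡ p))

    representative : Fin n → Fin n
    representative y = if s y then y else c y

    pair-representative : ∀ y → pair (representative y) (s y) ≡ y
    pair-representative y with s y
    ... | true  = refl
    ... | false = c-involutive y

    s-representative : ∀ y → T (s (representative y))
    s-representative y with s y in sy
    ... | true  = Equivalence.from T-≡ sy
    ... | false = Equivalence.from T-≡ (trans (s-c y) (cong not sy))

    representative-pair : ∀ {x} → T (s x) → ∀ b → representative (pair x b) ≡ x
    representative-pair p b rewrite s-pair p b with b
    ... | true  = refl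
    ... | false = c-involutive _

    to : Fin (count s) × Bool → Fin n
    to (i , b) = pair (proj₁ (E.to i)) b

    from : Fin n → Fin (count s) × Bool
    from y = E.from (representative y , s-representative y) , s y

    to-from : ∀ y → to (from y) ≡ y
    to-from y = trans (cong (λ x → pair (proj₁ x) (s y)) (E.strictlyInverseˡ _)) (pair-representative y)

    from-to : ∀ x → from (to x) ≡ x
    from-to (i , b) = cong₂ _,_
      (trans (cong E.from (Σ-≡,≡→≡ (representative-pair (proj₂ (E.to i)) b , T-irrelevant _ _)))
             (E.strictlyInverseʳ i))
      (s-pair (proj₂ (E.to i)) b)

  halve : (Fin (count s) × Bool) ↔ Fin n
  halve = mk↔ₛ′ to from to-from from-to

  s-halve : ∀ i b → s (Inverse.to halve (i , b)) ≡ b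
  s-halve i = s-pair (proj₂ (E.to i))

  c-halve : ∀ i b → c (Inverse.to halve (i , b)) ≡ Inverse.to halve (i , not b)
  c-halve i true  = refl
  c-halve i false = c-involutive _

-- Co-twins and the 2-colouring

module _ {n} (G : Graph n) where

  closedN-self : ∀ x → closedN G x x ≡ true
  closedN-self x = cong (_∨ adj G x x) (⌊⌋-yes (x ≟ x) refl)

  closedN-true : ∀ {x y} → closedN G x y ≡ true → x ≡ y ⊎ adj G x y ≡ true
  closedN-true {x} {y} xy with x ≟ y
  ... | yes x≡y = inj₁ x≡y
  ... | no _    = inj₂ xy

  closedN-automorphism : ∀ {σ} → IsAutomorphism G σ →
                         ∀ x y → closedN G (σ ⟨$⟩ʳ x) (σ ⟨$⟩ʳ y) ≡ closedN G x y
  closedN-automorphism {σ} σ-aut x y =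
    cong₂ _∨_ (⌊≟⌋-injective _≟_ _≟_ (↔-injective σ) x y) (σ-aut x y)

  coTwins-sym : ∀ {a b} → CoTwins G a b → CoTwins G b a
  coTwins-sym {a} {b} (a≢b , disjoint , cover) =
    a≢b ∘ sym ,
    (λ w → trans (∧-comm (closedN G b w) _) (disjoint w)) ,
    (λ w → trans (∨-comm (closedN G b w) _) (cover w))

  coTwins-automorphism : ∀ {σ a b} → IsAutomorphism G σ →
                         CoTwins G a b → CoTwins G (σ ⟨$⟩ʳ a) (σ ⟨$⟩ʳ b)
  coTwins-automorphism {σ} {a} {b} σ-aut (a≢b , disjoint , cover) =
    a≢b ∘ ↔-injective σ ,
    ∀-via σ (λ w → trans (cong₂ _∧_ (closedN-σ a w) (closedN-σ b w)) (disjoint w)) ,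
    ∀-via σ (λ w → trans (cong₂ _∨_ (closedN-σ a w) (closedN-σ b w)) (cover w))
    where closedN-σ = closedN-automorphism {σ} σ-aut

  closedN-coTwin : ∀ {a b} → CoTwins G a b → ∀ w → closedN G b w ≡ not (closedN G a w)
  closedN-coTwin (_ , disjoint , cover) w = partition⇒≡not (disjoint w) (cover w)

  coTwins-cover : ∀ {a b} → CoTwins G a b →
                  ∀ w → (a ≡ w ⊎ adj G a w ≡ true) ⊎ (b ≡ w ⊎ adj G b w ≡ true)
  coTwins-cover (_ , _ , cover) w with ∨-true (cover w)
  ... | inj₁ aw = inj₁ (closedN-true aw)
  ... | inj₂ bw = inj₂ (closedN-true bw)

  coTwins-nonadjacent : ∀ {a b} → CoTwins G a b → adj G a b ≡ false
  coTwins-nonadjacent {a} {b} ab =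
    ∨-conicalʳ _ _ (trans (closedN-coTwin (coTwins-sym ab) b) (cong not (closedN-self b)))

  coTwins-noCommonNeighbour : ∀ {a b w} → CoTwins G a b → adj G a w ≡ true → adj G b w ≡ false
  coTwins-noCommonNeighbour {a} {b} {w} ab aw =
    ∨-conicalʳ _ _ (trans (closedN-coTwin ab w) (cong not (trans (cong (⌊ a ≟ w ⌋ ∨_) aw) (∨-zeroʳ _))))

  coTwin-unique : TwinFree G → ∀ {a b b′} → CoTwins G a b → CoTwins G a b′ → b ≡ b′
  coTwin-unique twinFree {b = b} {b′} ab ab′ = decidable-stable (b ≟ b′) λ b≢b′ →
    proj₂ (twinFree b b′ b≢b′) λ w → trans (closedN-coTwin ab w) (sym (closedN-coTwin ab′ w))

  side : Fin n → Fin n → Fin n → Bool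
  side a b x = ⌊ a ≟ x ⌋ ∨ adj G b x

  side-independent : TriangleFree G → ∀ {a b x y} → CoTwins G a b →
                     side a b x ≡ true → side a b y ≡ true → adj G x y ≡ false
  side-independent triangleFree {a} {b} {x} {y} ab ax ay with a ≟ x | a ≟ y
  ... | yes refl | yes refl = irrfl G a
  ... | yes refl | no _     = coTwins-noCommonNeighbour (coTwins-sym ab) ay
  ... | no _     | yes refl = trans (adj-sym G x a) (coTwins-noCommonNeighbour (coTwins-sym ab) ax)
  ... | no _     | no _     = ¬-not λ xy → triangleFree (b , x , y , ax , xy , ay)

  side-cover : ∀ {a b x} → CoTwins G a b → side a b x ≡ false → side b a x ≡ true
  side-cover {a} {b} {x} ab ax with coTwins-cover ab x
  ... | inj₁ (inj₁ a≡x) =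
    contradiction (trans (sym ax) (cong (_∨ adj G b x) (⌊⌋-yes (a ≟ x) a≡x))) λ ()
  ... | inj₁ (inj₂ ax′) = trans (cong (⌊ b ≟ x ⌋ ∨_) ax′) (∨-zeroʳ _)
  ... | inj₂ (inj₁ b≡x) = cong (_∨ adj G a x) (⌊⌋-yes (b ≟ x) b≡x)
  ... | inj₂ (inj₂ bx)  =
    contradiction (trans (sym ax) (trans (cong (⌊ a ≟ x ⌋ ∨_) bx) (∨-zeroʳ _))) λ ()

  side-proper : TriangleFree G → ∀ {a b x y} → CoTwins G a b →
                adj G x y ≡ true → side a b y ≡ not (side a b x)
  side-proper triangleFree {a} {b} {x} {y} ab xy with side a b x in ax | side a b y in ay
  ... | true  | true  = contradiction (trans (sym xy) (side-independent triangleFree ab ax ay)) λ ()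
  ... | true  | false = refl
  ... | false | true  = refl
  ... | false | false = contradiction
    (trans (sym xy) (side-independent triangleFree (coTwins-sym ab) (side-cover ab ax) (side-cover ab ay))) λ ()

module CoTwinMap {n} (G : Graph n) (vertexTransitive : VertexTransitive G) (twinFree : TwinFree G)
                 {u v} (uv : CoTwins G u v) where

  coTwin : Fin n → Fin n
  coTwin x = proj₁ (vertexTransitive u x) ⟨$⟩ʳ v

  coTwins-coTwin : ∀ x → CoTwins G x (coTwin x)
  coTwins-coTwin x with vertexTransitive u x
  ... | σ , σ-aut , refl = coTwins-automorphism G {σ} σ-aut uv

  coTwin-involutive : ∀ x → coTwin (coTwin x) ≡ x
  coTwin-involutive x = coTwin-unique G twinFree (coTwins-coTwin (coTwin x)) (coTwins-sym G (coTwins-coTwin x))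

  coTwin-base : coTwin u ≡ v
  coTwin-base = coTwin-unique G twinFree (coTwins-coTwin u) uv

module ProperColouring {n} (G : Graph n) (c : Fin n → Fin n) (coTwins-c : ∀ x → CoTwins G x (c x))
                 (c-involutive : ∀ x → c (c x) ≡ x)
                 (s : Fin n → Bool) (s-proper : ∀ {x y} → adj G x y ≡ true → s y ≡ not (s x)) where

  sameColour-nonadjacent : ∀ {x y} → s y ≡ s x → adj G x y ≡ false
  sameColour-nonadjacent xy = ¬-not λ x~y → not-¬ xy (s-proper x~y)

  private
    Swapped : Fin n → Set
    Swapped b = s (c b) ≡ not (s b)

    swapped-coTwin : ∀ {b} → Swapped b → Swapped (c b)
    swapped-coTwin {b} sb = trans (cong s (c-involutive b)) (sym (trans (cong not sb) (not-involutive _)))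

    sameColour⇒inPair : ∀ {b x} → s b ≡ s x → s (c x) ≡ s x → b ≡ x ⊎ b ≡ c x
    sameColour⇒inPair {b} {x} bx cx with coTwins-cover G (coTwins-c x) b
    ... | inj₁ (inj₁ x≡b) = inj₁ (sym x≡b)
    ... | inj₁ (inj₂ x~b) = contradiction (trans (sym x~b) (sameColour-nonadjacent bx)) λ ()
    ... | inj₂ (inj₁ cx≡b) = inj₂ (sym cx≡b)
    ... | inj₂ (inj₂ cx~b) = contradiction (trans (sym cx~b) (sameColour-nonadjacent (trans bx (sym cx)))) λ ()

    swapped≢unswapped : ∀ {b x} → Swapped b → s (c x) ≡ s x → s b ≢ s x
    swapped≢unswapped {b} {x} sb cx bx with sameColour⇒inPair bx cx
    ... | inj₁ refl = not-¬ (trans cx (sym bx)) sb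
    ... | inj₂ refl = not-¬ (trans (cong s (c-involutive x)) (sym cx)) sb

  -- If x and c x had the same colour, N[x] ∪ N[c x] = V would force every vertex of that colour
  -- to be x or c x. One of a, c a has that colour, so its co-twin would have it too.
  coTwin-colour : ∀ {a} → s (c a) ≡ not (s a) → ∀ x → s (c x) ≡ not (s x)
  coTwin-colour {a} sa x = ¬-not λ cx → case s a Bool.≟ s x of λ where
    (yes ax) → swapped≢unswapped sa cx ax
    (no ax)  → swapped≢unswapped (swapped-coTwin sa) cx
                 (trans sa (trans (cong not (¬-not ax)) (not-involutive (s x))))

  adj-oppositeColours : (∀ x → s (c x) ≡ not (s x)) →
                        ∀ {x y} → s y ≡ not (s x) → adj G x y ≡ not ⌊ c x ≟ y ⌋
  adj-oppositeColours s-c {x} {y} xy with c x ≟ y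
  ... | yes refl = coTwins-nonadjacent G (coTwins-c x)
  ... | no cx≢y with coTwins-cover G (coTwins-c x) y
  ...   | inj₁ (inj₁ refl) = contradiction xy (not-¬ refl)
  ...   | inj₁ (inj₂ x~y) = x~y
  ...   | inj₂ (inj₁ cx≡y) = contradiction cx≡y cx≢y
  ...   | inj₂ (inj₂ cx~y) =
    contradiction (trans (sym cx~y) (sameColour-nonadjacent (trans xy (sym (s-c x))))) λ ()

-- The crown graph

-- K_{m,m} minus a perfect matching: the colour classes are Fin m × {true} and Fin m × {false},
-- and (i , a) is matched with (i , not a).
crownAdj : ∀ {m} → Fin m × Bool → Fin m × Bool → Bool
crownAdj (i , a) (j , b) = (a xor b) ∧ not ⌊ i ≟ j ⌋

avoid-pair : ∀ {m} → 3 ≤ m → (i j : Fin m) → ∃[ l ] (i ≢ l × j ≢ l)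
avoid-pair (s≤s (s≤s (s≤s _))) i j with i ≟ j
... | yes refl = punchIn i zero , punchInᵢ≢i i zero ∘ sym , punchInᵢ≢i i zero ∘ sym
... | no i≢j   = punchIn i (punchIn j′ zero) , punchInᵢ≢i i _ ∘ sym , avoids-j
  where
    j′ = punchOut i≢j
    avoids-j : j ≢ punchIn i (punchIn j′ zero)
    avoids-j e = punchInᵢ≢i j′ zero (punchIn-injective i _ _ (trans (sym e) (sym (punchIn-punchOut i≢j))))

crownAdj-cross : ∀ {m} {i j : Fin m} → i ≢ j → ∀ a → crownAdj (i , a) (j , not a) ≡ true
crownAdj-cross {i = i} {j} i≢j a = cong₂ _∧_ (xor-inverseʳ a) (cong not (⌊⌋-no (i ≟ j) i≢j))

crownAdj-colour : ∀ {m} (x y : Fin m × Bool) → crownAdj x y ≡ true → proj₂ y ≡ not (proj₂ x)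
crownAdj-colour (_ , true)  (_ , false) _ = refl
crownAdj-colour (_ , false) (_ , true)  _ = refl

crownAdj-index : ∀ {m} {i j : Fin m} {a b} → b ≡ not a → crownAdj (i , a) (j , b) ≡ false → i ≡ j
crownAdj-index {i = i} {j} {a} refl e = decidable-stable (i ≟ j) λ i≢j →
  contradiction (trans (sym e) (crownAdj-cross i≢j a)) λ ()

crownAdj-self : ∀ {m} (i : Fin m) a b → crownAdj (i , a) (i , b) ≡ false
crownAdj-self i a b = trans (cong (λ t → (a xor b) ∧ not t) (⌊⌋-yes (i ≟ i) refl)) (∧-zeroʳ _)

crown-connected : ∀ {m} {A : Set} → 3 ≤ m → (g : Fin m × Bool → A) →
                  (∀ x y → crownAdj x y ≡ true → g x ≡ g y) → ∀ x y → g x ≡ g y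
crown-connected {m} 3≤m g g-edge = connect
  where
    same-side : ∀ i j a → g (i , a) ≡ g (j , a)
    same-side i j a with avoid-pair 3≤m i j
    ... | l , i≢l , j≢l = trans (g-edge _ _ (crownAdj-cross i≢l a)) (sym (g-edge _ _ (crownAdj-cross j≢l a)))

    across : ∀ i j a → g (i , a) ≡ g (j , not a)
    across i j a with avoid-pair 3≤m i i
    ... | l , i≢l , _ = trans (g-edge _ _ (crownAdj-cross i≢l a)) (same-side l j (not a))

    connect : ∀ x y → g x ≡ g y
    connect (i , true)  (j , true)  = same-side i j true
    connect (i , false) (j , false) = same-side i j false
    connect (i , true)  (j , false) = across i j true
    connect (i , false) (j , true)  = across i j false

crownAdj-product : ∀ {m} (π : Permutation′ m) d i a j b →
                   crownAdj (π ⟨$⟩ʳ i , a xor d) (π ⟨$⟩ʳ j , b xor d) ≡ crownAdj (i , a) (j , b)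
crownAdj-product π d i a j b =
  cong₂ (λ p q → p ∧ not q) (xor-cancelʳ d a b) (⌊≟⌋-injective _≟_ _≟_ (↔-injective π) i j)

module CrownMap {m} (3≤m : 3 ≤ m) where

  base : Fin m
  base = fromℕ< 3≤m

  index : (Fin m × Bool → Fin m × Bool) → Fin m → Fin m
  index f i = proj₁ (f (i , false))

  shift : (Fin m × Bool → Fin m × Bool) → Bool
  shift f = proj₂ (f (base , false))

  module _ (f : Fin m × Bool → Fin m × Bool) (f-adj : ∀ x y → crownAdj (f x) (f y) ≡ crownAdj x y) where

    private
      colourShift : Fin m × Bool → Bool
      colourShift x = proj₂ x xor proj₂ (f x)

      colourShift-edge : ∀ x y → crownAdj x y ≡ true → colourShift x ≡ colourShift y
      colourShift-edge x y xy = sym (trans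
        (cong₂ _xor_ (crownAdj-colour x y xy) (crownAdj-colour (f x) (f y) (trans (f-adj x y) xy)))
        (xor-annihilates-not (proj₂ x) (proj₂ (f x))))

      colour : ∀ i a → proj₂ (f (i , a)) ≡ a xor shift f
      colour i a = xor-moveˡ a (crown-connected 3≤m colourShift colourShift-edge (i , a) (base , false))

      index-colour : ∀ i a → proj₁ (f (i , a)) ≡ proj₁ (f (i , not a))
      index-colour i a = crownAdj-index
        (trans (colour i (not a)) (trans (sym (not-distribˡ-xor a (shift f))) (cong not (sym (colour i a)))))
        (trans (f-adj (i , a) (i , not a)) (crownAdj-self i a (not a)))

    shape : ∀ i a → f (i , a) ≡ (index f i , a xor shift f)
    shape i true  = cong₂ _,_ (index-colour i true) (colour i true)
    shape i false = cong₂ _,_ refl (colour i false)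

record CrownLabelling {n} (G : Graph n) (m : ℕ) : Set where
  field
    label     : (Fin m × Bool) ↔ Fin n
    adj-label : ∀ x y → adj G (Inverse.to label x) (Inverse.to label y) ≡ crownAdj x y

crownLabelling : ∀ {n} (G : Graph n) → VertexTransitive G → TwinFree G → TriangleFree G →
                 ∀ {u v} → CoTwins G u v → ∃[ m ] CrownLabelling G m
crownLabelling G vertexTransitive twinFree triangleFree {u} {v} uv =
  count s , record { label = halve ; adj-label = adj-halve }
  where
    open CoTwinMap G vertexTransitive twinFree uv
    s = side G u v
    open ProperColouring G coTwin coTwins-coTwin coTwin-involutive s (side-proper G triangleFree uv)

    s-coTwin : ∀ x → s (coTwin x) ≡ not (s x)
    s-coTwin = coTwin-colour (begin
      s (coTwin u)          ≡⟨ cong s coTwin-base ⟩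
      ⌊ u ≟ v ⌋ ∨ adj G v v ≡⟨ cong₂ _∨_ (⌊⌋-no (u ≟ v) (proj₁ uv)) (irrfl G v) ⟩
      false                 ≡⟨ cong (λ b → not (b ∨ adj G v u)) (⌊⌋-yes (u ≟ u) refl) ⟨
      not (s u)             ∎)
      where open ≡-Reasoning

    open Halving s coTwin coTwin-involutive s-coTwin

    ℓ = Inverse.to halve

    crossing : ∀ i j a → adj G (ℓ (i , a)) (ℓ (j , not a)) ≡ not ⌊ i ≟ j ⌋
    crossing i j a = begin
      adj G (ℓ (i , a)) (ℓ (j , not a))
        ≡⟨ adj-oppositeColours s-coTwin (trans (s-halve j (not a)) (cong not (sym (s-halve i a)))) ⟩
      not ⌊ coTwin (ℓ (i , a)) ≟ ℓ (j , not a) ⌋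
        ≡⟨ cong (λ z → not ⌊ z ≟ ℓ (j , not a) ⌋) (c-halve i a) ⟩
      not ⌊ ℓ (i , not a) ≟ ℓ (j , not a) ⌋
        ≡⟨ cong not (⌊≟⌋-injective _≟_ _≟_ (,-injectiveˡ ∘ ↔-injective halve {_ , not a} {_ , not a})
                                    i j) ⟩
      not ⌊ i ≟ j ⌋ ∎
      where open ≡-Reasoning

    adj-halve : ∀ x y → adj G (ℓ x) (ℓ y) ≡ crownAdj x y
    adj-halve (i , true)  (j , true)  = sameColour-nonadjacent (trans (s-halve j true) (sym (s-halve i true)))
    adj-halve (i , false) (j , false) = sameColour-nonadjacent (trans (s-halve j false) (sym (s-halve i false)))
    adj-halve (i , true)  (j , false) = crossing i j true
    adj-halve (i , false) (j , true)  = crossing i j false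

module _ {n m} {G : Graph n} (L : CrownLabelling G m) where
  open CrownLabelling L

  closedN-label : ∀ x y → closedN G (Inverse.to label x) (Inverse.to label y) ≡
                          ⌊ ≡-dec _≟_ Bool._≟_ x y ⌋ ∨ crownAdj x y
  closedN-label x y =
    cong₂ _∨_ (⌊≟⌋-injective (≡-dec _≟_ Bool._≟_) _≟_ (↔-injective label) x y) (adj-label x y)

  labelling-order : m * 2 ≡ n
  labelling-order = P.↔⇒≡ (↔-trans *↔× (↔-trans (↔-refl ×-↔ 2↔Bool) label))

-- For m = 1 the two vertices are open twins; for m = 2, (0 , true) and (1 , false) are closed twins.
twinFree⇒3≤ : ∀ {n m} {G : Graph n} → TwinFree G → Fin n → CrownLabelling G m → 3 ≤ m
twinFree⇒3≤ {m = 0} _ w L = case Inverse.from (CrownLabelling.label L) w of λ ()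
twinFree⇒3≤ {m = 1} {G} twinFree _ L = ⊥-elim $
  proj₁ (twinFree (ℓ (zero , true)) (ℓ (zero , false)) (λ e → case ↔-injective label e of λ ()))
        (∀-via label λ { (zero , b) → trans (adj-label (zero , true) (zero , b))
                                        (trans (both-false b) (sym (adj-label (zero , false) (zero , b)))) })
  where
    open CrownLabelling L
    ℓ = Inverse.to label
    both-false : ∀ b → crownAdj {1} (zero , true) (zero , b) ≡ crownAdj {1} (zero , false) (zero , b)
    both-false true  = refl
    both-false false = refl
twinFree⇒3≤ {m = 2} {G} twinFree _ L = ⊥-elim $
  proj₂ (twinFree (ℓ (zero , true)) (ℓ (suc zero , false)) (λ e → case ↔-injective label e of λ ()))
        (∀-via label λ y → trans (closedN-label L (zero , true) y)
                                 (trans (same y) (sym (closedN-label L (suc zero , false) y))))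
  where
    open CrownLabelling L
    ℓ = Inverse.to label
    same : ∀ y → ⌊ ≡-dec _≟_ Bool._≟_ (zero , true) y ⌋ ∨ crownAdj {2} (zero , true) y ≡
                 ⌊ ≡-dec _≟_ Bool._≟_ (suc zero , false) y ⌋ ∨ crownAdj {2} (suc zero , false) y
    same (zero , true) = refl
    same (zero , false) = refl
    same (suc zero , true) = refl
    same (suc zero , false) = refl
twinFree⇒3≤ {m = suc (suc (suc _))} _ _ _ = s≤s (s≤s (s≤s z≤n))

-- S₂ is identified with (Bool, xor) through whether 0 and 1 are swapped.
transposeIf : Bool → Permutation′ 2
transposeIf false = P.id
transposeIf true  = P.transpose zero (suc zero)

swaps : Permutation′ 2 → Bool
swaps τ = Inverse.to 2↔Bool (τ ⟨$⟩ʳ zero)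

swaps-transposeIf : ∀ d → swaps (transposeIf d) ≡ d
swaps-transposeIf false = refl
swaps-transposeIf true  = refl

transposeIf-swaps : ∀ τ → transposeIf (swaps τ) P.≈ τ
transposeIf-swaps τ zero with τ ⟨$⟩ʳ zero
... | zero     = refl
... | suc zero = refl
transposeIf-swaps τ (suc zero) with τ ⟨$⟩ʳ zero in τ₀ | τ ⟨$⟩ʳ suc zero in τ₁
... | zero     | suc zero = refl
... | suc zero | zero     = refl
... | zero     | zero     = case ↔-injective τ (trans τ₀ (sym τ₁)) of λ ()
... | suc zero | suc zero = case ↔-injective τ (trans τ₀ (sym τ₁)) of λ ()

transposeIf-cong : ∀ {d e} → d ≡ e → transposeIf d P.≈ transposeIf e
transposeIf-cong refl _ = refl

transposeIf-xor : ∀ d e → transposeIf (d xor e) P.≈ transposeIf d ∘ₚ transposeIf e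
transposeIf-xor false e _          = refl
transposeIf-xor true false _       = refl
transposeIf-xor true true zero     = refl
transposeIf-xor true true (suc zero) = refl

xorPerm : Bool → Bool ↔ Bool
xorPerm d = mk↔ₛ′ (_xor d) (_xor d) (xor-involutive d) (xor-involutive d)
  where
    xor-involutive : ∀ d x → (x xor d) xor d ≡ x
    xor-involutive d true  = xor-inverseˡ d
    xor-involutive d false = xor-same d

-- Automorphisms of a crown-labelled graph

module CrownAutomorphisms {n m} (G : Graph n) (L : CrownLabelling G m) (3≤m : 3 ≤ m) where
  open CrownLabelling L
  open CrownMap 3≤m using (base) renaming (index to crownIndex; shift to crownShift)

  private
    ℓ = Inverse.to label
    ℓ⁻¹ = Inverse.from label

  conjugate : Permutation′ n → Fin m × Bool → Fin m × Bool
  conjugate σ x = ℓ⁻¹ (σ ⟨$⟩ʳ ℓ x)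

  conjugate-adj : ∀ {σ} → IsAutomorphism G σ →
                  ∀ x y → crownAdj (conjugate σ x) (conjugate σ y) ≡ crownAdj x y
  conjugate-adj {σ} σ-aut x y = begin
    crownAdj (conjugate σ x) (conjugate σ y)       ≡⟨ adj-label _ _ ⟨
    adj G (ℓ (conjugate σ x)) (ℓ (conjugate σ y))  ≡⟨ cong₂ (adj G) (Inverse.strictlyInverseˡ label _)
                                                                     (Inverse.strictlyInverseˡ label _) ⟩
    adj G (σ ⟨$⟩ʳ ℓ x) (σ ⟨$⟩ʳ ℓ y)                 ≡⟨ σ-aut (ℓ x) (ℓ y) ⟩
    adj G (ℓ x) (ℓ y)                              ≡⟨ adj-label x y ⟩
    crownAdj x y                                   ∎
    where open ≡-Reasoning

  index : Aut G → Fin m → Fin m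
  index (σ , _) = crownIndex (conjugate σ)

  shift : Aut G → Bool
  shift (σ , _) = crownShift (conjugate σ)

  conjugate-shape : ∀ α i a → conjugate (proj₁ α) (i , a) ≡ (index α i , a xor shift α)
  conjugate-shape (σ , σ-aut) = CrownMap.shape 3≤m (conjugate σ) (conjugate-adj {σ} σ-aut)

  automorphism-shape : ∀ α i a → proj₁ α ⟨$⟩ʳ ℓ (i , a) ≡ ℓ (index α i , a xor shift α)
  automorphism-shape α i a = trans (sym (Inverse.strictlyInverseˡ label _)) (cong ℓ (conjugate-shape α i a))

  conjugate-∘ : ∀ α β i a → conjugate (proj₁ (_∘ᴬ_ G α β)) (i , a) ≡
                            (index β (index α i) , (a xor shift α) xor shift β)
  conjugate-∘ α β i a =
    trans (cong (λ z → ℓ⁻¹ (proj₁ β ⟨$⟩ʳ z)) (automorphism-shape α i a)) (conjugate-shape β _ _)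

  index-∘ : ∀ α β i → index (_∘ᴬ_ G α β) i ≡ index β (index α i)
  index-∘ α β i = cong proj₁ (conjugate-∘ α β i false)

  shift-∘ : ∀ α β → shift (_∘ᴬ_ G α β) ≡ shift α xor shift β
  shift-∘ α β = cong proj₂ (conjugate-∘ α β base false)

  index-cong : ∀ {α β} → _≈ᴬ_ G α β → ∀ i → index α i ≡ index β i
  index-cong α≈β i = cong (proj₁ ∘ ℓ⁻¹) (α≈β (ℓ (i , false)))

  shift-cong : ∀ {α β} → _≈ᴬ_ G α β → shift α ≡ shift β
  shift-cong α≈β = cong (proj₂ ∘ ℓ⁻¹) (α≈β (ℓ (base , false)))

  Aut-inverse : Aut G → Aut G
  Aut-inverse (σ , σ-aut) = P.flip σ , λ x y →
    trans (sym (σ-aut _ _)) (cong₂ (adj G) (P.inverseʳ σ) (P.inverseʳ σ))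

  Aut-id : Aut G
  Aut-id = P.id , λ _ _ → refl

  index-cancel : ∀ α β → _≈ᴬ_ G (_∘ᴬ_ G β α) Aut-id → ∀ i → index α (index β i) ≡ i
  index-cancel α β βα≈id i = begin
    index α (index β i)    ≡⟨ index-∘ β α i ⟨
    index (_∘ᴬ_ G β α) i   ≡⟨ index-cong {_∘ᴬ_ G β α} {Aut-id} βα≈id i ⟩
    proj₁ (ℓ⁻¹ (ℓ (i , false))) ≡⟨ cong proj₁ (Inverse.strictlyInverseʳ label _) ⟩
    i                      ∎
    where open ≡-Reasoning

  indexPerm : Aut G → Permutation′ m
  indexPerm α@(σ , _) = P.permutation (index α) (index (Aut-inverse α))
    (index-cancel α (Aut-inverse α) (λ _ → P.inverseʳ σ))
    (index-cancel (Aut-inverse α) α (λ _ → P.inverseˡ σ))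

  act : Permutation′ m → Bool → Permutation′ n
  act π d = ↔-trans (↔-sym label) (↔-trans (π ×-↔ xorPerm d) label)

  act-label : ∀ π d i a → act π d ⟨$⟩ʳ ℓ (i , a) ≡ ℓ (π ⟨$⟩ʳ i , a xor d)
  act-label π d i a = cong (ℓ ∘ map (π ⟨$⟩ʳ_) (_xor d)) (Inverse.strictlyInverseʳ label (i , a))

  act-automorphism : ∀ π d → IsAutomorphism G (act π d)
  act-automorphism π d = ∀-via label λ (i , a) → ∀-via label λ (j , b) → begin
    adj G (act π d ⟨$⟩ʳ ℓ (i , a)) (act π d ⟨$⟩ʳ ℓ (j , b))
      ≡⟨ cong₂ (adj G) (act-label π d i a) (act-label π d j b) ⟩
    adj G (ℓ (π ⟨$⟩ʳ i , a xor d)) (ℓ (π ⟨$⟩ʳ j , b xor d))  ≡⟨ adj-label _ _ ⟩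
    crownAdj (π ⟨$⟩ʳ i , a xor d) (π ⟨$⟩ʳ j , b xor d)      ≡⟨ crownAdj-product π d i a j b ⟩
    crownAdj (i , a) (j , b)                                ≡⟨ adj-label _ _ ⟨
    adj G (ℓ (i , a)) (ℓ (j , b))                           ∎
    where open ≡-Reasoning

  act-cong : ∀ {π π′ d d′} → π P.≈ π′ → d ≡ d′ → act π d P.≈ act π′ d′
  act-cong {π} {π′} {d} π≈π′ refl = ∀-via label λ (i , a) → begin
    act π d ⟨$⟩ʳ ℓ (i , a)    ≡⟨ act-label π d i a ⟩
    ℓ (π ⟨$⟩ʳ i , a xor d)    ≡⟨ cong (λ j → ℓ (j , a xor d)) (π≈π′ i) ⟩
    ℓ (π′ ⟨$⟩ʳ i , a xor d)   ≡⟨ act-label π′ d i a ⟨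
    act π′ d ⟨$⟩ʳ ℓ (i , a)   ∎
    where open ≡-Reasoning

  act-index-shift : ∀ α → act (indexPerm α) (shift α) P.≈ proj₁ α
  act-index-shift α = ∀-via label λ (i , a) →
    trans (act-label (indexPerm α) (shift α) i a) (sym (automorphism-shape α i a))

  conjugate-act : ∀ π d i a → conjugate (act π d) (i , a) ≡ (π ⟨$⟩ʳ i , a xor d)
  conjugate-act π d i a = trans (cong ℓ⁻¹ (act-label π d i a)) (Inverse.strictlyInverseʳ label _)

  toSym : Aut G → Sym×S₂ m
  toSym α = indexPerm α , transposeIf (shift α)

  fromSym : Sym×S₂ m → Aut G
  fromSym (π , τ) = act π (swaps τ) , act-automorphism π (swaps τ)

  index-fromSym : ∀ π τ i → index (fromSym (π , τ)) i ≡ π ⟨$⟩ʳ i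
  index-fromSym π τ i = cong proj₁ (conjugate-act π (swaps τ) i false)

  shift-fromSym : ∀ π τ → shift (fromSym (π , τ)) ≡ swaps τ
  shift-fromSym π τ = cong proj₂ (conjugate-act π (swaps τ) base false)

  isomorphism : AutIso G m
  isomorphism = record
    { to        = toSym
    ; from      = fromSym
    ; to-cong   = λ {α} {β} α≈β → index-cong {α} {β} α≈β , transposeIf-cong (shift-cong {α} {β} α≈β)
    ; from-cong = λ { {π , _} {π′ , _} (π≈π′ , τ≈τ′) →
                    act-cong {π} {π′} π≈π′ (cong (Inverse.to 2↔Bool) (τ≈τ′ zero)) }
    ; to-hom    = λ α β → index-∘ α β ,
                    λ t → trans (transposeIf-cong (shift-∘ α β) t) (transposeIf-xor (shift α) (shift β) t)
    ; to-from   = λ (π , τ) → index-fromSym π τ ,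
                    λ t → trans (transposeIf-cong (shift-fromSym π τ) t) (transposeIf-swaps τ t)
    ; from-to   = λ α x →
                    trans (act-cong {indexPerm α} {indexPerm α} (λ _ → refl) (swaps-transposeIf (shift α)) x)
                          (act-index-shift α x)
    }

corollary37 : (k : ℕ) (G : Graph (2 * k)) →
    VertexTransitive G → TwinFree G → HasCoTwins G → TriangleFree G →
    AutIso G k
corollary37 k G vertexTransitive twinFree (u , v , uv) triangleFree =
  subst (AutIso G) m≡k (CrownAutomorphisms.isomorphism G L (twinFree⇒3≤ twinFree u L))
  where
    m = proj₁ (crownLabelling G vertexTransitive twinFree triangleFree uv)
    L = proj₂ (crownLabelling G vertexTransitive twinFree triangleFree uv)
    m≡k : m ≡ k
    m≡k = *-cancelʳ-≡ m k 2 (trans (labelling-order L) (*-comm 2 k))
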